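{- Let $G$ be drawn uniformly at random from $\mathbb{C}(n,R,m)$. For any $t\in\mathbb{N}$, run synchronous peeling (in the modified form retaining all variable nodes) for $t$ rounds on $G$, producing the residual graph $J_t$. Suppose that for some $(\widetilde R,\tilde m,\tilde n_1,\tilde n_2)$, $J_t\in\mathbb{C}(n,\widetilde R,\tilde m;\tilde n_1,\tilde n_2)$ with positive probability. Then, conditioned on this event, $J_t$ is uniformly random within $\mathbb{C}(n,\widetilde R,\tilde m;\tilde n_1,\tilde n_2)$.
   Context: Configuration model $\mathbb{C}(n,R,m)$, for a distribution $R$ on $\{0,\dots,k\}$: $n$ labeled variable nodes and $m$ labeled check nodes, of which $mR_l$ (a fixed partition) have degree $l$; each check of degree $l$ has $l$ distinct half-edges, each attached to an arbitrary variable node (multiple edges allowed); a graph is a choice of variable for every half-edge, and "uniform" means uniform over all such choices. $\mathbb{C}(n,R,m;n_1,n_2)$ is the subset of $\mathbb{C}(n,R,m)$ of graphs with exactly $n_1$ variables of degree $1$ and exactly $n_2$ variables of degree $\ge2$. Synchronous peeling, modified: in each round all variables of degree $\le1$ in the current graph are identified, all checks adjacent to them are deleted together with all their edges, but variable nodes are retained (as isolated nodes). Convention: the surviving checks of $J_t$ are relabeled consecutively preserving their order. -}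

module Defs where

open import Data.Nat using (ℕ; zero; suc; _+_; _≤ᵇ_; _≡ᵇ_)
open import Data.Bool using (Bool; not)
open import Data.Fin using (Fin)
open import Data.Fin.Properties using () renaming (_≟_ to _≟ᶠ_)
open import Data.List using (List; []; _∷_; _++_; replicate; map; length; filterᵇ; allFin)
open import Data.Nat.ListAction using (sum)
open import Data.Bool.ListAction using (any)
open import Relation.Nullary.Decidable using (isYes)
open import Relation.Binary.PropositionalEquality using (_≡_)

-- A (bipartite multi)graph in the configuration model on n variables:
-- the list of checks in order; check j is the list of variables its
-- half-edges (in order) are attached to.
Graph : ℕ → Set
Graph n = List (List (Fin n))

-- The fixed partition of check degrees: given counts c = (c₀,…,c_k),
-- c_l = m R_l, the first c₀ checks have degree 0, the next c₁ degree 1, …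
degsFrom : ℕ → List ℕ → List ℕ
degsFrom l []       = []
degsFrom l (x ∷ xs) = replicate x l ++ degsFrom (suc l) xs

degs : List ℕ → List ℕ
degs = degsFrom 0

-- G ∈ ℂ(n,R,m), where c encodes (R,m) via c_l = m R_l (so m = sum c).
InC : (n : ℕ) → List ℕ → Graph n → Set
InC n c G = map length G ≡ degs c

vdeg : {n : ℕ} → Fin n → Graph n → ℕ
vdeg v G = sum (map (λ ch → length (filterᵇ (λ w → isYes (v ≟ᶠ w)) ch)) G)

numDeg1 : (n : ℕ) → Graph n → ℕ
numDeg1 n G = length (filterᵇ (λ v → vdeg v G ≡ᵇ 1) (allFin n))

numDeg≥2 : (n : ℕ) → Graph n → ℕ
numDeg≥2 n G = length (filterᵇ (λ v → 2 ≤ᵇ vdeg v G) (allFin n))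

InC' : (n : ℕ) → List ℕ → ℕ → ℕ → Graph n → Set
InC' n c n₁ n₂ G = InC n c G × (numDeg1 n G ≡ n₁ × numDeg≥2 n G ≡ n₂)
  where open import Data.Product using (_×_)

-- one round of (modified) synchronous peeling: delete every check adjacent
-- to a variable of degree ≤ 1 in the current graph; variables are kept
-- (the vertex set Fin n is unchanged); surviving checks keep their order.
peelRound : {n : ℕ} → Graph n → Graph n
peelRound G = filterᵇ (λ ch → not (any (λ v → vdeg v G ≤ᵇ 1) ch)) G

peel : {n : ℕ} → ℕ → Graph n → Graph n
peel zero    G = G
peel (suc t) G = peel t (peelRound G)

{-# OPTIONS --safe #-}
module Submission where

-- A round of peeling depends only on which variables have degree ≤ 1.  Given H, H′ in
-- ℂ(n,R̃,m̃;ñ₁,ñ₂), permute the variables so that each has the same degree class (0, 1 or ≥ 2)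
-- in H and in H′; relabelling commutes with peeling and preserves ℂ(n,R,m), so the fibres of
-- G ↦ peel t G over H and over the permuted H correspond.  For H and H′ with the same degree
-- classes and check degrees, replace in G the checks surviving t rounds by those of H′, round by
-- round from the innermost residual outwards.  Every variable keeps its degree class at every
-- round, so each round deletes the same checks as before; this maps the fibre over H onto the
-- fibre over H′, and grafting H back is the inverse.

open import Axiom.UniquenessOfIdentityProofs using (module Decidable⇒UIP)
open import Data.Bool using (Bool; true; false; not; T; T?; if_then_else_)
open import Data.Bool.ListAction using (any; or)
open import Data.Bool.Properties using (T-≡; T-not-≡)
open import Data.Fin using (Fin; zero; suc; punchIn)
open import Data.Fin.Permutation
  using (Permutation′; _⟨$⟩ʳ_; _⟨$⟩ˡ_; flip; inverseˡ; inverseʳ; insert; insert-punchIn)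
import Data.Fin.Permutation as Permutation
open import Data.Fin.Properties using () renaming (_≟_ to _≟ᶠ_)
open import Data.List using (List; []; _∷_; map; length; filterᵇ; tabulate; allFin)
open import Data.List.Membership.Propositional using (_∈_; find; lose)
open import Data.List.Membership.Propositional.Properties using (∈-filter⁻)
open import Data.List.Properties
  using (filter-accept; filter-≐; ∷-injective; length-map; map-cong; map-∘; map-id; ≡-dec)
open import Data.List.Relation.Unary.All using (All; []; _∷_)
import Data.List.Relation.Unary.All as All
open import Data.List.Relation.Unary.Any using (here; there)
open import Data.List.Relation.Unary.Any.Properties using (any⁺; any⁻)
open import Data.Nat using (ℕ; zero; suc; _+_; _<_; _≤ᵇ_; _≡ᵇ_; z≤n; s≤s)
open import Data.Nat.ListAction using (sum)
open import Data.Nat.Properties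
  using ( _≟_; +-assoc; +-cancelˡ-≡; +-cancelʳ-≡; +-0-commutativeMonoid; +-commutativeSemigroup
        ; suc-injective; ≤-trans; m≤m+n; m≤n+m; n≢0⇒n>0; <⇒≢)
open import Algebra.Properties.CommutativeMonoid.Sum +-0-commutativeMonoid
  using (sum-cong-≗; sum-remove; ∑-distrib-+) renaming (sum to ∑)
open import Algebra.Properties.CommutativeSemigroup +-commutativeSemigroup using (x∙yz≈y∙xz)
open import Data.Product using (Σ; ∃; _×_; _,_; proj₁; proj₂)
open import Defs
open import Function using (_∘_)
open import Function.Bundles using (_↔_; mk↔ₛ′; Equivalence; Injection)
open import Function.Definitions using (Injective)
open import Function.Properties.Inverse using (↔⇒↣; ↔-trans)
open import Relation.Binary.Definitions using (DecidableEquality)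
open import Relation.Binary.PropositionalEquality
  using (_≡_; _≢_; _≗_; refl; sym; trans; cong; cong₂; subst; module ≡-Reasoning)
open import Relation.Nullary using (¬_; yes; no; contradiction)
open import Relation.Nullary.Decidable using (isYes; toWitness; fromWitness)

module _ {A : Set} where

  overwrite : (A → Bool) → List A → List A → List A
  overwrite p []       ys       = []
  overwrite p (x ∷ xs) ys       with p x
  overwrite p (x ∷ xs) ys       | false = x ∷ overwrite p xs ys
  overwrite p (x ∷ xs) []       | true  = x ∷ overwrite p xs []
  overwrite p (x ∷ xs) (y ∷ ys) | true  = y ∷ overwrite p xs ys

  filterᵇ-cong : {p q : A → Bool} → p ≗ q → filterᵇ p ≗ filterᵇ q
  filterᵇ-cong p≗q = filter-≐ _ _ ((λ {x} → subst T (p≗q x)) , (λ {x} → subst T (sym (p≗q x))))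

  filterᵇ-map : {B : Set} (q : B → Bool) (g : A → B) (xs : List A) →
                filterᵇ q (map g xs) ≡ map g (filterᵇ (q ∘ g) xs)
  filterᵇ-map q g []       = refl
  filterᵇ-map q g (x ∷ xs) with q (g x)
  ... | true  = cong (g x ∷_) (filterᵇ-map q g xs)
  ... | false = filterᵇ-map q g xs

  map-inverse : {B : Set} {f : A → B} {g : B → A} → (∀ x → g (f x) ≡ x) → ∀ xs → map g (map f xs) ≡ xs
  map-inverse g∘f≗id xs = trans (sym (map-∘ xs)) (trans (map-cong g∘f≗id xs) (map-id xs))

  overwrite-cong : {p q : A → Bool} → p ≗ q → ∀ xs ys → overwrite p xs ys ≡ overwrite q xs ys
  overwrite-cong {p} {q} p≗q []       ys       = refl
  overwrite-cong {p} {q} p≗q (x ∷ xs) ys       with p x | q x | p≗q x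
  overwrite-cong p≗q (x ∷ xs) ys       | false | .false | refl = cong (x ∷_) (overwrite-cong p≗q xs ys)
  overwrite-cong p≗q (x ∷ xs) []       | true  | .true  | refl = cong (x ∷_) (overwrite-cong p≗q xs [])
  overwrite-cong p≗q (x ∷ xs) (y ∷ ys) | true  | .true  | refl = cong (y ∷_) (overwrite-cong p≗q xs ys)

  module _ (p : A → Bool) where

    sum-map-filterᵇ : (f : A → ℕ) (xs : List A) →
                      sum (map f xs) ≡ sum (map f (filterᵇ (not ∘ p) xs)) + sum (map f (filterᵇ p xs))
    sum-map-filterᵇ f []       = refl
    sum-map-filterᵇ f (x ∷ xs) with p x
    ... | true  = trans (cong (f x +_) (sum-map-filterᵇ f xs)) (x∙yz≈y∙xz (f x) dropped kept)
      where dropped = sum (map f (filterᵇ (not ∘ p) xs))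
            kept    = sum (map f (filterᵇ p xs))
    ... | false = trans (cong (f x +_) (sum-map-filterᵇ f xs)) (sym (+-assoc (f x) _ _))

    sum-map-overwrite : (f : A → ℕ) (xs ys : List A) → length ys ≡ length (filterᵇ p xs) →
                        sum (map f (overwrite p xs ys))
                          ≡ sum (map f (filterᵇ (not ∘ p) xs)) + sum (map f ys)
    sum-map-overwrite f []       []       _ = refl
    sum-map-overwrite f (x ∷ xs) ys       fits with p x
    sum-map-overwrite f (x ∷ xs) ys       fits | false =
      trans (cong (f x +_) (sum-map-overwrite f xs ys fits)) (sym (+-assoc (f x) _ _))
    sum-map-overwrite f (x ∷ xs) (y ∷ ys) fits | true  =
      trans (cong (f y +_) (sum-map-overwrite f xs ys (suc-injective fits)))
            (x∙yz≈y∙xz (f y) (sum (map f (filterᵇ (not ∘ p) xs))) (sum (map f ys)))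

    filterᵇ-overwrite : (xs ys : List A) → All (T ∘ p) ys → length ys ≡ length (filterᵇ p xs) →
                        filterᵇ p (overwrite p xs ys) ≡ ys
    filterᵇ-overwrite []       []       _          _ = refl
    filterᵇ-overwrite (x ∷ xs) ys       ps         fits with p x in px
    filterᵇ-overwrite (x ∷ xs) ys       ps         fits | false rewrite px =
      filterᵇ-overwrite xs ys ps fits
    filterᵇ-overwrite (x ∷ xs) (y ∷ ys) (py ∷ ps) fits | true  =
      trans (filter-accept (T? ∘ p) py) (cong (y ∷_) (filterᵇ-overwrite xs ys ps (suc-injective fits)))

    overwrite-overwrite : (xs ys : List A) → All (T ∘ p) ys → length ys ≡ length (filterᵇ p xs) →
                          overwrite p (overwrite p xs ys) (filterᵇ p xs) ≡ xs
    overwrite-overwrite []       []       _          _ = refl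
    overwrite-overwrite (x ∷ xs) ys       ps         fits with p x in px
    overwrite-overwrite (x ∷ xs) ys       ps         fits | false rewrite px =
      cong (x ∷_) (overwrite-overwrite xs ys ps fits)
    overwrite-overwrite (x ∷ xs) (y ∷ ys) (py ∷ ps) fits | true  rewrite Equivalence.to T-≡ py =
      cong (x ∷_) (overwrite-overwrite xs ys ps (suc-injective fits))

    map-overwrite : {B : Set} (g : A → B) (xs ys : List A) → map g ys ≡ map g (filterᵇ p xs) →
                    map g (overwrite p xs ys) ≡ map g xs
    map-overwrite g []       ys       _ = refl
    map-overwrite g (x ∷ xs) ys       eq with p x
    map-overwrite g (x ∷ xs) ys       eq | false = cong (g x ∷_) (map-overwrite g xs ys eq)
    map-overwrite g (x ∷ xs) (y ∷ ys) eq | true  =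
      cong₂ _∷_ (proj₁ (∷-injective eq)) (map-overwrite g xs ys (proj₂ (∷-injective eq)))

degClass : ℕ → ℕ
degClass zero          = 0
degClass (suc zero)    = 1
degClass (suc (suc _)) = 2

degClass-suc : ∀ x → degClass (suc x) ≡ degClass (suc (degClass x))
degClass-suc zero          = refl
degClass-suc (suc zero)    = refl
degClass-suc (suc (suc x)) = refl

degClass-+ : ∀ d {x y} → degClass x ≡ degClass y → degClass (d + x) ≡ degClass (d + y)
degClass-+ zero    eq = eq
degClass-+ (suc d) {x} {y} eq = begin
  degClass (suc (d + x))            ≡⟨ degClass-suc (d + x) ⟩
  degClass (suc (degClass (d + x))) ≡⟨ cong (degClass ∘ suc) (degClass-+ d eq) ⟩
  degClass (suc (degClass (d + y))) ≡⟨ degClass-suc (d + y) ⟨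
  degClass (suc (d + y))            ∎
  where open ≡-Reasoning

≤ᵇ1-degClass : ∀ x → (x ≤ᵇ 1) ≡ (degClass x ≤ᵇ 1)
≤ᵇ1-degClass zero          = refl
≤ᵇ1-degClass (suc zero)    = refl
≤ᵇ1-degClass (suc (suc x)) = refl

degClass≡0⇒≡0 : ∀ {x} → degClass x ≡ 0 → x ≡ 0
degClass≡0⇒≡0 {zero}          _  = refl
degClass≡0⇒≡0 {suc zero}      ()
degClass≡0⇒≡0 {suc (suc _)}   ()

module _ {n : ℕ} where

  mult : Fin n → List (Fin n) → ℕ
  mult v ch = length (filterᵇ (λ w → isYes (v ≟ᶠ w)) ch)

  ∈⇒0<mult : ∀ {v ch} → v ∈ ch → 0 < mult v ch
  ∈⇒0<mult {v} (here refl) with v ≟ᶠ v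
  ... | yes _   = s≤s z≤n
  ... | no v≢v = contradiction refl v≢v
  ∈⇒0<mult {v} {w ∷ _} (there v∈ch) with v ≟ᶠ w
  ... | yes _ = ≤-trans (∈⇒0<mult v∈ch) (m≤n+m _ 1)
  ... | no _  = ∈⇒0<mult v∈ch

  0<mult⇒∈ : ∀ {v} ch → 0 < mult v ch → v ∈ ch
  0<mult⇒∈ {v} (w ∷ ch) pos with v ≟ᶠ w
  ... | yes refl = here refl
  ... | no _     = there (0<mult⇒∈ ch pos)

  ∈⇒0<vdeg : ∀ {v ch G} → ch ∈ G → v ∈ ch → 0 < vdeg v G
  ∈⇒0<vdeg {v} {ch} (here refl) v∈ch = ≤-trans (∈⇒0<mult v∈ch) (m≤m+n (mult v ch) _)
  ∈⇒0<vdeg {v} {G = ch′ ∷ _} (there ch∈G) v∈ch = ≤-trans (∈⇒0<vdeg ch∈G v∈ch) (m≤n+m _ (mult v ch′))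

  0<vdeg⇒∈ : ∀ {v} G → 0 < vdeg v G → ∃ λ ch → ch ∈ G × v ∈ ch
  0<vdeg⇒∈ {v} (ch ∷ G) pos with mult v ch in eq
  ... | suc _ = ch , here refl , 0<mult⇒∈ ch (subst (0 <_) (sym eq) (s≤s z≤n))
  ... | zero  with 0<vdeg⇒∈ G pos
  ...   | ch′ , ch′∈G , v∈ch′ = ch′ , there ch′∈G , v∈ch′

  SameDegClasses : Graph n → Graph n → Set
  SameDegClasses G K = ∀ v → degClass (vdeg v G) ≡ degClass (vdeg v K)

  survives : Graph n → List (Fin n) → Bool
  survives G ch = not (any (λ v → vdeg v G ≤ᵇ 1) ch)

  survives⇒¬small : ∀ G {ch v} → T (survives G ch) → v ∈ ch → ¬ T (vdeg v G ≤ᵇ 1)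
  survives⇒¬small G surv v∈ch small = subst T (Equivalence.to T-not-≡ surv) (any⁺ _ (lose v∈ch small))

  ¬small⇒survives : ∀ G ch → (∀ {v} → v ∈ ch → ¬ T (vdeg v G ≤ᵇ 1)) → T (survives G ch)
  ¬small⇒survives G ch large with any (λ v → vdeg v G ≤ᵇ 1) ch in eq
  ... | false = _
  ... | true  with find (any⁻ _ ch (subst T (sym eq) _))
  ...   | v , v∈ch , small = large v∈ch small

  survives-cong : ∀ {G G′} → SameDegClasses G G′ → ∀ ch → survives G ch ≡ survives G′ ch
  survives-cong {G} {G′} same = cong (not ∘ or) ∘ map-cong small-cong
    where
    small-cong : ∀ v → (vdeg v G ≤ᵇ 1) ≡ (vdeg v G′ ≤ᵇ 1)
    small-cong v = begin
      vdeg v G ≤ᵇ 1             ≡⟨ ≤ᵇ1-degClass (vdeg v G) ⟩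
      degClass (vdeg v G) ≤ᵇ 1  ≡⟨ cong (_≤ᵇ 1) (same v) ⟩
      degClass (vdeg v G′) ≤ᵇ 1 ≡⟨ ≤ᵇ1-degClass (vdeg v G′) ⟨
      vdeg v G′ ≤ᵇ 1            ∎
      where open ≡-Reasoning

  -- This is where degree class 0 is needed: a variable on a check of K has positive degree
  -- in peelRound G, hence lies on a surviving check of G.
  residual-survives : ∀ G K → SameDegClasses (peelRound G) K → All (T ∘ survives G) K
  residual-survives G K same = All.tabulate (λ ch∈K → ¬small⇒survives G _ (large ch∈K))
    where
    large : ∀ {ch v} → ch ∈ K → v ∈ ch → ¬ T (vdeg v G ≤ᵇ 1)
    large {v = v} ch∈K v∈ch =
      let ch′ , ch′∈res , v∈ch′ = 0<vdeg⇒∈ (peelRound G) (n≢0⇒n>0 still-occurs)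
      in survives⇒¬small G (proj₂ (∈-filter⁻ (T? ∘ survives G) {xs = G} ch′∈res)) v∈ch′
      where
      still-occurs : vdeg v (peelRound G) ≢ 0
      still-occurs eq =
        <⇒≢ (∈⇒0<vdeg ch∈K v∈ch) (sym (degClass≡0⇒≡0 (trans (sym (same v)) (cong degClass eq))))

  graft : ℕ → Graph n → Graph n → Graph n
  graft zero    G K = K
  graft (suc t) G K = overwrite (survives G) G (graft t (peelRound G) K)

  record IsGraft (t : ℕ) (G K : Graph n) : Set where
    field
      peel-graft   : peel t (graft t G K) ≡ K
      same-classes : SameDegClasses G (graft t G K)
      same-shape   : map length (graft t G K) ≡ map length G
      graft-peel   : graft t (graft t G K) (peel t G) ≡ G

  open IsGraft

  isGraft-1 : ∀ G K → SameDegClasses (peelRound G) K → map length K ≡ map length (peelRound G) →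
              IsGraft 1 G K
  isGraft-1 G K classes shape = record
    { peel-graft   = trans (sym (filterᵇ-cong survives≗ G′)) (filterᵇ-overwrite p G K K-survives fits)
    ; same-classes = classes′
    ; same-shape   = map-overwrite p length G K shape
    ; graft-peel   = trans (sym (overwrite-cong survives≗ G′ (peelRound G)))
                           (overwrite-overwrite p G K K-survives fits)
    }
    where
    p  = survives G
    G′ = overwrite p G K

    fits : length K ≡ length (filterᵇ p G)
    fits = trans (sym (length-map length K))
                 (trans (cong length shape) (length-map length (peelRound G)))

    K-survives : All (T ∘ p) K
    K-survives = residual-survives G K classes

    classes′ : SameDegClasses G G′
    classes′ v = begin
      degClass (vdeg v G)                      ≡⟨ cong degClass (sum-map-filterᵇ p (mult v) G) ⟩
      degClass (peeled + vdeg v (peelRound G)) ≡⟨ degClass-+ peeled (classes v) ⟩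
      degClass (peeled + vdeg v K)             ≡⟨ cong degClass (sum-map-overwrite p (mult v) G K fits) ⟨
      degClass (vdeg v G′)                     ∎
      where
      open ≡-Reasoning
      peeled = sum (map (mult v) (filterᵇ (not ∘ p) G))

    survives≗ : p ≗ survives G′
    survives≗ = survives-cong {G} {G′} classes′

  isGraft : ∀ t G K → SameDegClasses (peel t G) K → map length K ≡ map length (peel t G) →
            IsGraft t G K
  isGraft zero    G K classes shape = record
    { peel-graft = refl ; same-classes = classes ; same-shape = shape ; graft-peel = refl }
  isGraft (suc t) G K classes shape = record
    { peel-graft   = trans (cong (peel t) (peel-graft step)) (peel-graft inner)
    ; same-classes = same-classes step
    ; same-shape   = same-shape step
    ; graft-peel   = begin
        overwrite (survives G′) G′ (graft t (peelRound G′) (peel t G₁))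
          ≡⟨ cong (λ R → overwrite (survives G′) G′ (graft t R (peel t G₁))) (peel-graft step) ⟩
        overwrite (survives G′) G′ (graft t K₁ (peel t G₁))
          ≡⟨ cong (overwrite (survives G′) G′) (graft-peel inner) ⟩
        overwrite (survives G′) G′ G₁
          ≡⟨ graft-peel step ⟩
        G ∎
    }
    where
    open ≡-Reasoning
    G₁ = peelRound G
    inner = isGraft t G₁ K classes shape
    K₁ = graft t G₁ K
    step = isGraft-1 G K₁ (same-classes inner) (same-shape inner)
    G′ = graft 1 G K₁

  relabel : (Fin n → Fin n) → Graph n → Graph n
  relabel σ = map (map σ)

  shape-relabel : ∀ σ G → map length (relabel σ G) ≡ map length G
  shape-relabel σ G = trans (sym (map-∘ G)) (map-cong (length-map σ) G)

  module _ {σ : Fin n → Fin n} (σ-injective : Injective _≡_ _≡_ σ) where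

    mult-relabel : ∀ v ch → mult (σ v) (map σ ch) ≡ mult v ch
    mult-relabel v []       = refl
    mult-relabel v (w ∷ ch) with v ≟ᶠ w | σ v ≟ᶠ σ w
    ... | yes _    | yes _     = cong suc (mult-relabel v ch)
    ... | no _     | no _      = mult-relabel v ch
    ... | yes v≡w  | no σv≢σw  = contradiction (cong σ v≡w) σv≢σw
    ... | no v≢w   | yes σv≡σw = contradiction (σ-injective σv≡σw) v≢w

    vdeg-relabel : ∀ v G → vdeg (σ v) (relabel σ G) ≡ vdeg v G
    vdeg-relabel v []       = refl
    vdeg-relabel v (ch ∷ G) = cong₂ _+_ (mult-relabel v ch) (vdeg-relabel v G)

    survives-relabel : ∀ G ch → survives (relabel σ G) (map σ ch) ≡ survives G ch
    survives-relabel G ch =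
      cong (not ∘ or) (trans (sym (map-∘ ch)) (map-cong (λ v → cong (_≤ᵇ 1) (vdeg-relabel v G)) ch))

    peelRound-relabel : ∀ G → peelRound (relabel σ G) ≡ relabel σ (peelRound G)
    peelRound-relabel G = trans (filterᵇ-map (survives (relabel σ G)) (map σ) G)
                                (cong (relabel σ) (filterᵇ-cong (survives-relabel G) G))

    peel-relabel : ∀ t G → peel t (relabel σ G) ≡ relabel σ (peel t G)
    peel-relabel zero    G = refl
    peel-relabel (suc t) G = trans (cong (peel t) (peelRound-relabel G)) (peel-relabel t (peelRound G))

permute : ∀ {n} → Permutation′ n → Graph n → Graph n
permute π = relabel (π ⟨$⟩ʳ_)

⟨$⟩ʳ-injective : ∀ {n} (π : Permutation′ n) → Injective _≡_ _≡_ (π ⟨$⟩ʳ_)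
⟨$⟩ʳ-injective π = Injection.injective (↔⇒↣ π)

module _ {n : ℕ} (c : List ℕ) (t : ℕ) where

  InFibre : Graph n → Graph n → Set
  InFibre H G = InC n c G × peel t G ≡ H

  Fibre : Graph n → Set
  Fibre H = Σ (Graph n) (InFibre H)

  InFibre-irrelevant : ∀ {H G} (p q : InFibre H G) → p ≡ q
  InFibre-irrelevant (i , e) (i′ , e′) =
    cong₂ _,_ (Decidable⇒UIP.≡-irrelevant (≡-dec _≟_) i i′)
              (Decidable⇒UIP.≡-irrelevant (≡-dec (≡-dec _≟ᶠ_)) e e′)

  fibre-≡ : ∀ {H G G′} {p : InFibre H G} {p′ : InFibre H G′} → G ≡ G′ →
            _≡_ {A = Fibre H} (G , p) (G′ , p′)
  fibre-≡ {p = p} {p′} refl = cong (_ ,_) (InFibre-irrelevant p p′)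

  fibre-↔ : ∀ {H K} (f g : Graph n → Graph n) →
            (∀ {G} → InFibre H G → InFibre K (f G)) → (∀ {G} → InFibre K G → InFibre H (g G)) →
            (∀ {G} → InFibre H G → g (f G) ≡ G) → (∀ {G} → InFibre K G → f (g G) ≡ G) →
            Fibre H ↔ Fibre K
  fibre-↔ f g f-maps g-maps g∘f fg = mk↔ₛ′
    (λ (G , p) → f G , f-maps p) (λ (G , p) → g G , g-maps p)
    (λ (G , p) → fibre-≡ (fg p)) (λ (G , p) → fibre-≡ (g∘f p))

  fibre-permute : ∀ (π : Permutation′ n) H → Fibre H ↔ Fibre (permute π H)
  fibre-permute π H = fibre-↔ (permute π) (permute (flip π))
    (λ {G} (i , e) → trans (shape-relabel _ G) i ,
                     trans (peel-relabel (⟨$⟩ʳ-injective π) t G) (cong (permute π) e))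
    (λ {G} (i , e) → trans (shape-relabel _ G) i ,
                     trans (peel-relabel (⟨$⟩ʳ-injective (flip π)) t G)
                           (trans (cong (permute (flip π)) e)
                                  (map-inverse (map-inverse (λ _ → inverseˡ π)) H)))
    (λ {G} _ → map-inverse (map-inverse (λ _ → inverseˡ π)) G)
    (λ {G} _ → map-inverse (map-inverse (λ _ → inverseʳ π)) G)

  fibre-graft : ∀ {H K} → SameDegClasses H K → map length H ≡ map length K → Fibre H ↔ Fibre K
  fibre-graft {H} {K} classes shape = fibre-↔ (λ G → graft t G K) (λ G → graft t G H)
    (λ {G} (i , e) → let g = to-K e in trans (same-shape g) i , peel-graft g)
    (λ {G} (i , e) → let g = to-H e in trans (same-shape g) i , peel-graft g)
    (λ {G} (_ , e) → trans (cong (graft t (graft t G K)) (sym e)) (graft-peel (to-K e)))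
    (λ {G} (_ , e) → trans (cong (graft t (graft t G H)) (sym e)) (graft-peel (to-H e)))
    where
    open IsGraft
    to-K : ∀ {G} → peel t G ≡ H → IsGraft t G K
    to-K {G} refl = isGraft t G K classes (sym shape)
    to-H : ∀ {G} → peel t G ≡ K → IsGraft t G H
    to-H {G} refl = isGraft t G H (sym ∘ classes) shape

count : ∀ {n} → (Fin n → Bool) → ℕ
count p = ∑ (λ i → if p i then 1 else 0)

count-cong : ∀ {n} {p q : Fin n → Bool} → p ≗ q → count p ≡ count q
count-cong p≗q = sum-cong-≗ (cong (λ b → if b then 1 else 0) ∘ p≗q)

count-true : ∀ n → count {n} (λ _ → true) ≡ n
count-true zero    = refl
count-true (suc n) = cong suc (count-true n)

count-partition₃ : ∀ {n} (p q r : Fin n → Bool) →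
                   (∀ i → (if p i then 1 else 0) + ((if q i then 1 else 0) + (if r i then 1 else 0)) ≡ 1) →
                   count p + (count q + count r) ≡ n
count-partition₃ {n} p q r exactly-one = begin
  count p + (count q + count r)           ≡⟨ cong (count p +_) (∑-distrib-+ (ind q) (ind r)) ⟨
  count p + ∑ (λ i → ind q i + ind r i)   ≡⟨ ∑-distrib-+ (ind p) _ ⟨
  ∑ (λ i → ind p i + (ind q i + ind r i)) ≡⟨ sum-cong-≗ exactly-one ⟩
  count {n} (λ _ → true)                  ≡⟨ count-true n ⟩
  n                                       ∎
  where
  open ≡-Reasoning
  ind : (Fin n → Bool) → Fin n → ℕ
  ind s i = if s i then 1 else 0

0<count : ∀ {n} (p : Fin n → Bool) j → T (p j) → 0 < count p
0<count p zero    pj with p zero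
... | true = s≤s z≤n
0<count p (suc j) pj = ≤-trans (0<count (p ∘ suc) j pj) (m≤n+m _ (if p zero then 1 else 0))

0<count⇒∃ : ∀ {n} (p : Fin n → Bool) → 0 < count p → ∃ λ j → T (p j)
0<count⇒∃ {suc n} p pos with p zero in eq
... | true  = zero , subst T (sym eq) _
... | false = let j , pj = 0<count⇒∃ (p ∘ suc) pos in suc j , pj

length-filterᵇ-tabulate : ∀ {A : Set} {n} (p : A → Bool) (h : Fin n → A) →
                          length (filterᵇ p (tabulate h)) ≡ count (p ∘ h)
length-filterᵇ-tabulate {n = zero}  p h = refl
length-filterᵇ-tabulate {n = suc n} p h with p (h zero)
... | true  = cong suc (length-filterᵇ-tabulate p (h ∘ suc))
... | false = length-filterᵇ-tabulate p (h ∘ suc)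

length-filterᵇ-allFin : ∀ {n} (p : Fin n → Bool) → length (filterᵇ p (allFin n)) ≡ count p
length-filterᵇ-allFin p = length-filterᵇ-tabulate p (λ v → v)

module _ {A : Set} (_≟ᴬ_ : DecidableEquality A) where

  SameValueCounts : ∀ {n} → (Fin n → A) → (Fin n → A) → Set
  SameValueCounts f g = ∀ a → count (λ i → isYes (f i ≟ᴬ a)) ≡ count (λ i → isYes (g i ≟ᴬ a))

  matching-permutation : ∀ {n} (f g : Fin n → A) → SameValueCounts f g →
                         Σ (Permutation′ n) λ π → ∀ i → g (π ⟨$⟩ʳ i) ≡ f i
  matching-permutation {zero}  f g _    = Permutation.id , λ ()
  matching-permutation {suc n} f g same = insert zero j π , matches
    where
    open ≡-Reasoning
    a = f zero
    ind : A → A → ℕ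
    ind x b = if isYes (x ≟ᴬ b) then 1 else 0

    hit : ∃ λ j → T (isYes (g j ≟ᴬ a))
    hit = 0<count⇒∃ _ (subst (0 <_) (same a) (0<count (λ i → isYes (f i ≟ᴬ a)) zero (fromWitness refl)))
    j = proj₁ hit
    gj≡a : g j ≡ a
    gj≡a = toWitness (proj₂ hit)

    same′ : SameValueCounts (f ∘ suc) (g ∘ punchIn j)
    same′ b = +-cancelˡ-≡ (ind a b) _ _ (begin
      count (λ i → isYes (f i ≟ᴬ b))  ≡⟨ same b ⟩
      count (λ i → isYes (g i ≟ᴬ b))  ≡⟨ sum-remove {i = j} (λ i → ind (g i) b) ⟩
      ind (g j) b + counted-rest b    ≡⟨ cong (λ x → ind x b + counted-rest b) gj≡a ⟩
      ind a b + counted-rest b        ∎)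
      where
      counted-rest : A → ℕ
      counted-rest b = count (λ i → isYes (g (punchIn j i) ≟ᴬ b))

    rest = matching-permutation (f ∘ suc) (g ∘ punchIn j) same′
    π = proj₁ rest

    matches : ∀ i → g (insert zero j π ⟨$⟩ʳ i) ≡ f i
    matches zero    = gj≡a
    matches (suc i) = trans (cong g (insert-punchIn zero j π i)) (proj₂ rest i)

degClassOf : ∀ {n} → Graph n → Fin n → ℕ
degClassOf H v = degClass (vdeg v H)

module _ {n : ℕ} where

  private
    classIs : Graph n → ℕ → Fin n → Bool
    classIs H a v = isYes (degClassOf H v ≟ a)

    classIs-1 : ∀ x → isYes (degClass x ≟ 1) ≡ (x ≡ᵇ 1)
    classIs-1 zero          = refl
    classIs-1 (suc zero)    = refl
    classIs-1 (suc (suc x)) = refl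

    classIs-2 : ∀ x → isYes (degClass x ≟ 2) ≡ (2 ≤ᵇ x)
    classIs-2 zero          = refl
    classIs-2 (suc zero)    = refl
    classIs-2 (suc (suc x)) = refl

    classIs-≥3 : ∀ x k → isYes (degClass x ≟ suc (suc (suc k))) ≡ false
    classIs-≥3 zero          k = refl
    classIs-≥3 (suc zero)    k = refl
    classIs-≥3 (suc (suc x)) k = refl

    one-class : ∀ x → (if isYes (degClass x ≟ 0) then 1 else 0)
                        + ((if isYes (degClass x ≟ 1) then 1 else 0)
                           + (if isYes (degClass x ≟ 2) then 1 else 0)) ≡ 1
    one-class zero          = refl
    one-class (suc zero)    = refl
    one-class (suc (suc x)) = refl

    classes-partition : ∀ H → count (classIs H 0) + (count (classIs H 1) + count (classIs H 2)) ≡ n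
    classes-partition H =
      count-partition₃ (classIs H 0) (classIs H 1) (classIs H 2) (λ v → one-class (vdeg v H))

  same-degClass-counts : ∀ (H H′ : Graph n) → numDeg1 n H ≡ numDeg1 n H′ → numDeg≥2 n H ≡ numDeg≥2 n H′ →
                         SameValueCounts _≟_ (degClassOf H) (degClassOf H′)
  same-degClass-counts H H′ deg1 deg≥2 = counts
    where
    count-1 : ∀ G → count (classIs G 1) ≡ numDeg1 n G
    count-1 G = trans (count-cong (λ v → classIs-1 (vdeg v G)))
                      (sym (length-filterᵇ-allFin (λ v → vdeg v G ≡ᵇ 1)))

    count-2 : ∀ G → count (classIs G 2) ≡ numDeg≥2 n G
    count-2 G = trans (count-cong (λ v → classIs-2 (vdeg v G)))
                      (sym (length-filterᵇ-allFin (λ v → 2 ≤ᵇ vdeg v G)))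

    counts : SameValueCounts _≟_ (degClassOf H) (degClassOf H′)
    counts (suc zero)          = trans (count-1 H) (trans deg1 (sym (count-1 H′)))
    counts (suc (suc zero))    = trans (count-2 H) (trans deg≥2 (sym (count-2 H′)))
    counts (suc (suc (suc k))) = trans (count-cong (λ v → classIs-≥3 (vdeg v H) k))
                                      (sym (count-cong (λ v → classIs-≥3 (vdeg v H′) k)))
    counts zero = +-cancelʳ-≡ _ _ _ (trans (classes-partition H) (sym (trans
      (cong (count (classIs H′ 0) +_) (cong₂ _+_ (counts 1) (counts 2))) (classes-partition H′))))

  permute-SameDegClasses : ∀ {H H′} (π : Permutation′ n) →
                           (∀ i → degClassOf H′ (π ⟨$⟩ʳ i) ≡ degClassOf H i) → SameDegClasses (permute π H) H′
  permute-SameDegClasses {H} {H′} π matches w = begin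
    degClassOf (permute π H) w             ≡⟨ cong (degClassOf (permute π H)) (inverseʳ π) ⟨
    degClassOf (permute π H) (π ⟨$⟩ʳ i)   ≡⟨ cong degClass (vdeg-relabel (⟨$⟩ʳ-injective π) i H) ⟩
    degClassOf H i                         ≡⟨ matches i ⟨
    degClassOf H′ (π ⟨$⟩ʳ i)              ≡⟨ cong (degClassOf H′) (inverseʳ π) ⟩
    degClassOf H′ w                        ∎
    where
    open ≡-Reasoning
    i = π ⟨$⟩ˡ w

lemma5p3 : (n : ℕ) (c : List ℕ) (t : ℕ) (c̃ : List ℕ) (ñ₁ ñ₂ : ℕ) →
           (∃ λ (G : Graph n) → InC n c G × InC' n c̃ ñ₁ ñ₂ (peel t G)) →
           (H H′ : Graph n) → InC' n c̃ ñ₁ ñ₂ H → InC' n c̃ ñ₁ ñ₂ H′ →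
           (Σ (Graph n) λ G → InC n c G × peel t G ≡ H)
             ↔ (Σ (Graph n) λ G → InC n c G × peel t G ≡ H′)
lemma5p3 n c t c̃ ñ₁ ñ₂ _ H H′ (shape , deg1 , deg≥2) (shape′ , deg1′ , deg≥2′) =
  ↔-trans (fibre-permute c t π H)
          (fibre-graft c t (permute-SameDegClasses {H = H} {H′} π matches)
                           (trans (shape-relabel _ H) (trans shape (sym shape′))))
  where
  π,matches = matching-permutation _≟_ (degClassOf H) (degClassOf H′)
                (same-degClass-counts H H′ (trans deg1 (sym deg1′)) (trans deg≥2 (sym deg≥2′)))
  π = proj₁ π,matches
  matches = proj₂ π,matches
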